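{- For every $\varphi\in\mathrm{LTL}(\mathbf{F},\mathbf{G},\land)$ and every infinite word $w\in(2^{AP})^\omega$, $w\models\varphi$ if and only if $w$ is accepted by the automaton $\mathcal{A}_\varphi$.
   Context: Classical LTL over a finite set $AP$ of atomic propositions, interpreted over infinite words $w\in(2^{AP})^\omega$: $w,i\models a$ iff $a\in w(i)$, $\land$ as usual, $w,i\models\mathbf{F}\varphi$ iff $\exists j\ge i$: $w,j\models\varphi$, $w,i\models\mathbf{G}\varphi$ iff $\forall j\ge i$: $w,j\models\varphi$; $w\models\varphi$ means $w,0\models\varphi$. $\mathrm{LTL}(\mathbf{F},\mathbf{G},\land)$: formulas built from $\mathrm{true}$, atomic propositions, $\land,\mathbf{F},\mathbf{G}$ (conjunctions read up to associativity/commutativity). Pseudo-atomic: a conjunction of atomic propositions (empty = $\mathrm{true}$); $\mathrm{prop}(\bigwedge_{a\in A}a)=A$. A formula is flat if it has the form $\psi\land\mathbf{G}\psi'\land\bigwedge_{i\in I}\mathbf{G}\mathbf{F}\psi''_i\land\bigwedge_{j\in J}\mathbf{F}\varphi_j$ with $\psi,\psi',\psi''_i$ pseudo-atomic and each $\varphi_j$ flat. Writing $\varphi=\psi\land\bigwedge_{i\in I}\mathbf{G}\varphi_i\land\bigwedge_{j\in J}\mathbf{F}\varphi_j$ ($\psi$ pseudo-atomic), define $\mathrm{flat}_{\mathbf G}(\varphi)=\mathbf{G}\psi\land\bigwedge_I\mathrm{flat}_{\mathbf G}(\varphi_i)\land\bigwedge_J\mathrm{flat}_{\mathbf{GF}}(\varphi_j)$,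 $\mathrm{flat}_{\mathbf{GF}}(\varphi)=\mathbf{GF}\psi\land\bigwedge_I\mathrm{flat}_{\mathbf{FG}}(\varphi_i)\land\bigwedge_J\mathrm{flat}_{\mathbf{GF}}(\varphi_j)$, $\mathrm{flat}_{\mathbf{FG}}(\varphi)=\mathbf{FG}\psi\land\bigwedge_I\mathrm{flat}_{\mathbf{FG}}(\varphi_i)\land\bigwedge_J\mathrm{flat}_{\mathbf{GF}}(\varphi_j)$, $\mathrm{flat}(\varphi)=\psi\land\bigwedge_I\mathrm{flat}_{\mathbf G}(\varphi_i)\land\bigwedge_J\mathbf{F}\,\mathrm{flat}(\varphi_j)$. Unfolding: $\mathfrak U(\mathrm{true})=\{\mathrm{true}\}$, $\mathfrak U(a)=\{a\}$, $\mathfrak U(\mathbf G\varphi)=\{\mathbf G\varphi\}$, $\mathfrak U(\varphi_1\land\varphi_2)=\{\psi_1\land\psi_2:\psi_k\in\mathfrak U(\varphi_k)\}$, $\mathfrak U(\mathbf F\varphi)=\{\mathbf F\varphi\}\cup\mathfrak U(\varphi)$. For $A\subseteq AP$ and flat $\varphi=\psi\land\mathbf{G}\psi'\land\bigwedge_I\mathbf{GF}\psi''_i\land\bigwedge_J\mathbf{F}\varphi_j$, let $\varphi[A]=\mathbf{G}\psi'\land\bigwedge_I\mathbf{GF}\psi''_i\land\bigwedge_J\mathbf{F}\varphi_j$ if $\mathrm{prop}(\psi\land\psi')\subseteq A$, and $\varphi[A]=\mathrm{false}$ otherwise. The automaton $\mathcal A_\varphi$ has states the flat formulas of $\mathrm{LTL}(\mathbf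 F,\mathbf G,\land)$, alphabet $2^{AP}$, a transition $\psi\xrightarrow{A}\psi'$ iff there is $\psi''\in\mathfrak U(\psi)$ with $\psi'=\psi''[A]\neq\mathrm{false}$, and initial state $q_0=\mathrm{flat}(\varphi)$. Let $\#_{\mathbf F}(\mathrm{true})=\#_{\mathbf F}(a)=\#_{\mathbf F}(\mathbf G\varphi)=0$, $\#_{\mathbf F}(\varphi_1\land\varphi_2)=\#_{\mathbf F}(\varphi_1)+\#_{\mathbf F}(\varphi_2)$, $\#_{\mathbf F}(\mathbf F\varphi)=1+\#_{\mathbf F}(\varphi)$. Let $F$ be the set of states $q$ with $q_0\to^+q$ (reachable by a nonempty path) and $\#_{\mathbf F}(q)=0$; each $q\in F$ has the form $\mathbf G\psi\land\bigwedge_{j\in J}\mathbf{GF}\psi'_j$, and for such $q$ let $T_{q,j}$ be the set of transitions $(q,A,q)$ with $\mathrm{prop}(\psi'_j)\subseteq A$. A word $w$ is accepted by $\mathcal A_\varphi$ iff there exist $q\in F$ and an infinite path from $q_0$ labeled by $w$ that visits $q$ and, for each $j\in J$, uses a transition of $T_{q,j}$ infinitely often. -}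

module Defs where

open import Data.Nat using (ℕ; zero; suc; _+_; _≤_)
open import Data.Fin using (Fin)
open import Data.Fin.Subset using (Subset; ⁅_⁆; _∈_; _⊆_; _∪_; ⊥)
open import Data.Unit using (⊤)
open import Data.List using (List; []; _∷_; _++_)
open import Data.List.Relation.Unary.All using (All)
open import Data.Product using (Σ; ∃; ∃-syntax; _×_)
open import Relation.Binary.PropositionalEquality using (_≡_)

data Form (n : ℕ) : Set where
  tt   : Form n
  atom : Fin n → Form n
  _∧_  : Form n → Form n → Form n
  𝐅    : Form n → Form n
  𝐆    : Form n → Form n

Letter : ℕ → Set
Letter n = Subset n

Word : ℕ → Set
Word n = ℕ → Letter n

infix 4 _,_⊨_
_,_⊨_ : ∀ {n} → Word n → ℕ → Form n → Set
w , i ⊨ tt      = ⊤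
w , i ⊨ atom a  = a ∈ w i
w , i ⊨ φ ∧ ψ   = (w , i ⊨ φ) × (w , i ⊨ ψ)
w , i ⊨ 𝐅 φ     = ∃[ j ] (i ≤ j × w , j ⊨ φ)
w , i ⊨ 𝐆 φ     = ∀ j → i ≤ j → w , j ⊨ φ

_⊨_ : ∀ {n} → Word n → Form n → Set
w ⊨ φ = w , 0 ⊨ φ

-- Flat formulas  ψ ∧ Gψ' ∧ ⋀_i GFψ''_i ∧ ⋀_j F φ_j  (up to AC),
-- pseudo-atomic formulas represented by their set of propositions.

data Flat (n : ℕ) : Set where
  flat : (now : Subset n) (glob : Subset n) (gf : List (Subset n))
         (fs : List (Flat n)) → Flat n

module _ {n : ℕ} where

  now : Flat n → Subset n
  now (flat p _ _ _) = p

  glob : Flat n → Subset n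
  glob (flat _ g _ _) = g

  gf : Flat n → List (Subset n)
  gf (flat _ _ l _) = l

  fs : Flat n → List (Flat n)
  fs (flat _ _ _ f) = f

  ε : Flat n
  ε = flat ⊥ ⊥ [] []

  -- conjunction of two flat formulas (G ψ ∧ G ψ' read as G (ψ ∧ ψ'))
  _⊗_ : Flat n → Flat n → Flat n
  flat p g l f ⊗ flat p' g' l' f' = flat (p ∪ p') (g ∪ g') (l ++ l') (f ++ f')

  -- prop of the top-level pseudo-atomic part ψ of φ = ψ ∧ ⋀ Gφ_i ∧ ⋀ Fφ_j
  atoms : Form n → Subset n
  atoms tt        = ⊥
  atoms (atom a)  = ⁅ a ⁆
  atoms (φ ∧ ψ)   = atoms φ ∪ atoms ψ
  atoms (𝐅 φ)     = ⊥
  atoms (𝐆 φ)     = ⊥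

  -- flat_G, flat_GF, flat_FG, flat ; the primed versions handle the
  -- ⋀_I G φ_i ∧ ⋀_J F φ_j part of the top-level decomposition.
  flatG flatGF flatFG flatTop : Form n → Flat n
  flatG' flatGF' flatFG' flatTop' : Form n → Flat n

  flatG φ   = flat ⊥ (atoms φ) [] [] ⊗ flatG' φ
  flatGF φ  = flat ⊥ ⊥ (atoms φ ∷ []) [] ⊗ flatGF' φ
  flatFG φ  = flat ⊥ ⊥ [] (flat ⊥ (atoms φ) [] [] ∷ []) ⊗ flatFG' φ
  flatTop φ = flat (atoms φ) ⊥ [] [] ⊗ flatTop' φ

  flatG' tt       = ε
  flatG' (atom _) = ε
  flatG' (φ ∧ ψ)  = flatG' φ ⊗ flatG' ψ
  flatG' (𝐆 φ)    = flatG φ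
  flatG' (𝐅 φ)    = flatGF φ

  flatGF' tt       = ε
  flatGF' (atom _) = ε
  flatGF' (φ ∧ ψ)  = flatGF' φ ⊗ flatGF' ψ
  flatGF' (𝐆 φ)    = flatFG φ
  flatGF' (𝐅 φ)    = flatGF φ

  flatFG' tt       = ε
  flatFG' (atom _) = ε
  flatFG' (φ ∧ ψ)  = flatFG' φ ⊗ flatFG' ψ
  flatFG' (𝐆 φ)    = flatFG φ
  flatFG' (𝐅 φ)    = flatGF φ

  flatTop' tt       = ε
  flatTop' (atom _) = ε
  flatTop' (φ ∧ ψ)  = flatTop' φ ⊗ flatTop' ψ
  flatTop' (𝐆 φ)    = flatG φ
  flatTop' (𝐅 φ)    = flat ⊥ ⊥ [] (flatTop φ ∷ [])

  -- Unfolding 𝔘 as a relation: Unf φ ψ  iff  ψ ∈ 𝔘(φ).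
  -- G-conjuncts (including GF) unfold to themselves; each F φ_j either
  -- stays F φ_j or is replaced by an element of 𝔘(φ_j).
  data Unf : Flat n → Flat n → Set
  data UnfL : List (Flat n) → Flat n → Set

  data Unf where
    unf : ∀ {p g l f r} → UnfL f r → Unf (flat p g l f) (flat p g l [] ⊗ r)

  data UnfL where
    []    : UnfL [] ε
    keep  : ∀ {φ f r} → UnfL f r → UnfL (φ ∷ f) (flat ⊥ ⊥ [] (φ ∷ []) ⊗ r)
    open′ : ∀ {φ f s r} → Unf φ s → UnfL f r → UnfL (φ ∷ f) (s ⊗ r)

  -- Transition ψ --A--> ψ'  iff  ∃ ψ'' ∈ 𝔘(ψ) with ψ' = ψ''[A] ≠ false
  Step : Flat n → Letter n → Flat n → Set
  Step q A q' = ∃[ u ] (Unf q u × (now u ∪ glob u) ⊆ A × q' ≡ flat ⊥ (glob u) (gf u) (fs u))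

  data Reach⁺ : Flat n → Flat n → Set where
    one  : ∀ {q A q'} → Step q A q' → Reach⁺ q q'
    more : ∀ {q A q' q''} → Step q A q' → Reach⁺ q' q'' → Reach⁺ q q''

  #F : Flat n → ℕ
  #Fs : List (Flat n) → ℕ
  #F (flat _ _ _ f) = #Fs f
  #Fs []      = 0
  #Fs (φ ∷ f) = suc (#F φ) + #Fs f

  q₀ : Form n → Flat n
  q₀ φ = flatTop φ

  InF : Form n → Flat n → Set
  InF φ q = Reach⁺ (q₀ φ) q × #F q ≡ 0

  Run : Form n → Word n → (ℕ → Flat n) → Set
  Run φ w ρ = ρ 0 ≡ q₀ φ × (∀ i → Step (ρ i) (w i) (ρ (suc i)))

  Accepted : Form n → Word n → Set
  Accepted φ w =
    ∃[ ρ ] (Run φ w ρ × ∃[ q ] (InF φ q × ∃[ i ] (ρ i ≡ q) ×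
      All (λ ψ' → ∀ m → ∃[ k ] (m ≤ k × ρ k ≡ q × ρ (suc k) ≡ q × ψ' ⊆ w k))
          (gf q)))

-- Read a flat formula with its F-obligations witnessed at explicit later positions.
-- Flattening preserves meaning: under G, GF and FG the conjuncts of
-- ψ ∧ ⋀ Gφᵢ ∧ ⋀ Fφⱼ separate, using GG = G, GFF = GF, GFG = FGG = FG and
-- FGF = GF; under GF and FG this works because the conjuncts Gφᵢ and Fφⱼ then
-- hold from some point on, so only the atoms ψ need to recur.  Each transition of
-- the automaton is backwards sound for this reading, and an accepting state holds
-- where the run reaches it, so an accepted word satisfies φ.  Conversely the
-- witnesses of a satisfying word are bounded by some D; unfolding each obligation
-- exactly at its witness gives a run that after D has no obligations left and so
-- loops on a single accepting state, whose GF-conjuncts then hold infinitely often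
-- along the loop.
module Submission where

open import Defs
open import Data.Nat using (ℕ; zero; suc; _≤_; _<_; _⊔_; s≤s; _≤′_; ≤′-refl; ≤′-step)
open import Data.Nat.Properties
  using (≤-refl; ≤-trans; n≤1+n; m≤n⇒m<n∨m≡n; m≤m⊔n; m≤n⊔m; m≤n⇒m≤n⊔o; m⊔n≤o⇒m≤o; m⊔n≤o⇒n≤o; <⇒≱; ≤⇒≤′; ≤′⇒≤)
open import Data.Fin.Subset using (Subset; _∈_; _⊆_; _∪_) renaming (⊥ to ∅)
open import Data.Fin.Subset.Properties
  using (⊥⊆; p⊆p∪q; q⊆p∪q; x∈p∪q⁻; x∈⁅x⁆; x∈⁅y⁆⇒x≡y; ∪-identityʳ)
open import Data.List using (List; []; _∷_; _++_)
open import Data.List.Properties using (++-identityʳ)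
open import Data.List.Relation.Unary.All using (All; []; _∷_) renaming (map to All-map)
open import Data.List.Relation.Unary.All.Properties using (++⁺; ++⁻)
open import Data.Product using (Σ-syntax; ∃-syntax; _×_; _,_; proj₁; proj₂)
open import Data.Sum using (inj₁; inj₂; [_,_])
open import Data.Unit using (⊤; tt)
open import Function.Base using (id; const; _∘_)
open import Function.Bundles using (_⇔_; mk⇔)
open import Relation.Nullary using (contradiction)
open import Relation.Binary.PropositionalEquality using (_≡_; refl; sym; trans; cong₂; subst)

private
  variable
    n i j t : ℕ
    p q r : Subset n
    P Q R : ℕ → Set

∪-⊆ : p ⊆ r → q ⊆ r → p ∪ q ⊆ r
∪-⊆ {p = p} {q = q} p⊆r q⊆r x∈ = [ p⊆r , q⊆r ] (x∈p∪q⁻ p q x∈)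

∪-⊆⁻ : p ∪ q ⊆ r → p ⊆ r × q ⊆ r
∪-⊆⁻ {q = q} p∪q⊆r = (λ x∈ → p∪q⊆r (p⊆p∪q q x∈)) , (λ x∈ → p∪q⊆r (q⊆p∪q _ q x∈))

□ ◇ : (ℕ → Set) → ℕ → Set
□ P i = ∀ j → i ≤ j → P j
◇ P i = ∃[ j ] (i ≤ j × P j)

□-map : (∀ {j} → P j → Q j) → □ P i → □ Q i
□-map f h j i≤j = f (h j i≤j)

□-zipWith : (∀ {j} → P j → Q j → R j) → □ P i → □ Q i → □ R i
□-zipWith f h h′ j i≤j = f (h j i≤j) (h′ j i≤j)

□-mp : □ P i → □ (λ k → P k → Q k) i → □ Q i
□-mp = □-zipWith λ p f → f p

□-now : □ P i → P i
□-now h = h _ ≤-refl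

□-later : i ≤ j → □ P i → □ P j
□-later i≤j h k j≤k = h k (≤-trans i≤j j≤k)

□-dup : □ P i → □ (□ P) i
□-dup h j i≤j = □-later i≤j h

□-back : P i → □ P (suc i) → □ P i
□-back {i = i} now later j i≤j with m≤n⇒m<n∨m≡n i≤j
... | inj₁ i<j  = later j i<j
... | inj₂ refl = now

◇-here : P i → ◇ P i
◇-here h = _ , ≤-refl , h

◇-map : (∀ {j} → P j → Q j) → ◇ P i → ◇ Q i
◇-map f (j , i≤j , h) = j , i≤j , f h

◇-join : ◇ (◇ P) i → ◇ P i
◇-join (j , i≤j , k , j≤k , h) = k , ≤-trans i≤j j≤k , h

□◇-back : □ (◇ P) (suc i) → □ (◇ P) i
□◇-back {i = i} h j i≤j = ◇-join (suc j , n≤1+n j , h (suc j) (s≤s i≤j))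

◇□-zipWith : (∀ {j} → P j → Q j → R j) → ◇ (□ P) i → ◇ (□ Q) i → ◇ (□ R) i
◇□-zipWith f (j , i≤j , h) (k , i≤k , h′) =
  j ⊔ k , ≤-trans i≤j (m≤m⊔n j k) ,
  □-zipWith f (□-later (m≤m⊔n j k) h) (□-later (m≤n⊔m j k) h′)

◇□-mp : ◇ (□ P) i → ◇ (□ (λ k → P k → Q k)) i → ◇ (□ Q) i
◇□-mp = ◇□-zipWith λ p f → f p

◇□⇒□◇ : ◇ (□ P) i → □ (◇ P) i
◇□⇒□◇ (k , _ , h) j _ = j ⊔ k , m≤m⊔n j k , h (j ⊔ k) (m≤n⊔m j k)

□◇-mp : □ (◇ P) i → ◇ (□ (λ k → P k → Q k)) i → □ (◇ Q) i
□◇-mp h (t , _ , f) j i≤j with h (j ⊔ t) (≤-trans i≤j (m≤m⊔n j t))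
... | k , j⊔t≤k , pk = k , m⊔n≤o⇒m≤o j t j⊔t≤k , f k (m⊔n≤o⇒n≤o j t j⊔t≤k) pk

eventually-constant : {A : Set} {f : ℕ → A} →
  (∀ k → t ≤ k → f (suc k) ≡ f k) → t ≤′ j → f j ≡ f t
eventually-constant stable ≤′-refl = refl
eventually-constant stable (≤′-step t≤′j) =
  trans (stable _ (≤′⇒≤ t≤′j)) (eventually-constant stable t≤′j)

module _ {n : ℕ} where

  Unf-now : ∀ {q u : Flat n} → Unf q u → now q ⊆ now u
  Unf-now (unf {r = flat _ _ _ _} _) = p⊆p∪q _

  Unf-glob : ∀ {q u : Flat n} → Unf q u → glob q ⊆ glob u
  Unf-glob (unf {r = flat _ _ _ _} _) = p⊆p∪q _

  Step-now : ∀ {q q′ : Flat n} {A} → Step q A q′ → now q ⊆ A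
  Step-now (u , q↝u , u⊆A , _) = proj₁ (∪-⊆⁻ u⊆A) ∘ Unf-now q↝u

  Step-glob : ∀ {q q′ : Flat n} {A} → Step q A q′ → glob q ⊆ A
  Step-glob (u , q↝u , u⊆A , _) = proj₂ (∪-⊆⁻ {q = glob u} u⊆A) ∘ Unf-glob q↝u

  Step-glob-mono : ∀ {q q′ : Flat n} {A} → Step q A q′ → glob q ⊆ glob q′
  Step-glob-mono (_ , q↝u , _ , refl) = Unf-glob q↝u

  Step-idle : ∀ (q : Flat n) {A q′} → now q ≡ ∅ → fs q ≡ [] → Step q A q′ → q′ ≡ q
  Step-idle (flat _ g l _) refl refl (_ , unf [] , _ , refl) =
    cong₂ (λ g l → flat ∅ g l []) (∪-identityʳ g) (++-identityʳ l)

  Reach⁺-snoc : ∀ {q q′ q″ : Flat n} {A} → Reach⁺ q q′ → Step q′ A q″ → Reach⁺ q q″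
  Reach⁺-snoc (one s)    s′ = more s (one s′)
  Reach⁺-snoc (more s r) s′ = more s (Reach⁺-snoc r s′)

  run-Reach⁺ : ∀ {ρ : ℕ → Flat n} {w : Word n} →
    (∀ i → Step (ρ i) (w i) (ρ (suc i))) → ∀ k → Reach⁺ (ρ 0) (ρ (suc k))
  run-Reach⁺ steps zero    = one (steps 0)
  run-Reach⁺ steps (suc k) = Reach⁺-snoc (run-Reach⁺ steps k) (steps (suc k))

  #F≡0⇒fs≡[] : ∀ (q : Flat n) → #F q ≡ 0 → fs q ≡ []
  #F≡0⇒fs≡[] (flat _ _ _ [])      _ = refl
  #F≡0⇒fs≡[] (flat _ _ _ (_ ∷ _)) ()

  fs≡[]⇒#F≡0 : ∀ (q : Flat n) → fs q ≡ [] → #F q ≡ 0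
  fs≡[]⇒#F≡0 (flat _ _ _ _) refl = refl

Within : ℕ → ℕ → ℕ → Set
Within D i j = i ≤ j × j ≤ D

Within-mono : ∀ {D D′} → D ≤ D′ → Within D i j → Within D′ i j
Within-mono D≤D′ (i≤j , j≤D) = i≤j , ≤-trans j≤D D≤D′

module _ {n : ℕ} (w : Word n) where

  Holds : Subset n → ℕ → Set
  Holds g i = g ⊆ w i

  Always InfOften : Subset n → ℕ → Set
  Always g = □ (Holds g)
  InfOften g = □ (◇ (Holds g))

  Always-∅ : Always ∅ i
  Always-∅ _ _ = ⊥⊆

  Always-∪ : Always p i → Always q i → Always (p ∪ q) i
  Always-∪ = □-zipWith ∪-⊆

  Always-∪⁻ : Always (p ∪ q) i → Always p i × Always q i
  Always-∪⁻ {q = q} h = (λ j i≤j → proj₁ (∪-⊆⁻ {q = q} (h j i≤j)))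
                      , (λ j i≤j → proj₂ (∪-⊆⁻ {q = q} (h j i≤j)))

  -- An F-obligation raised at i is witnessed at some j with W i j.  W = _≤_ gives
  -- the meaning of a flat formula; W = Within D also bounds all witnesses by D.
  module FlatSemantics (W : ℕ → ℕ → Set) where

    ⟦_⟧ : Flat n → ℕ → Set
    AllEventually : List (Flat n) → ℕ → Set
    ⟦ flat p g l f ⟧ i = Holds p i × Always g i × All (λ s → InfOften s i) l × AllEventually f i
    AllEventually []      i = ⊤
    AllEventually (φ ∷ f) i = (∃[ j ] (W i j × ⟦ φ ⟧ j)) × AllEventually f i

    ⟦⟧-intro : ∀ q → Holds (now q) i → Always (glob q) i → All (λ s → InfOften s i) (gf q) →
               AllEventually (fs q) i → ⟦ q ⟧ i
    ⟦⟧-intro (flat _ _ _ _) hp hg hl hf = hp , hg , hl , hf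

    ⟦⟧-gf : ∀ q → ⟦ q ⟧ i → All (λ s → InfOften s i) (gf q)
    ⟦⟧-gf (flat _ _ _ _) (_ , _ , hl , _) = hl

    ⟦⟧-fs : ∀ q → ⟦ q ⟧ i → AllEventually (fs q) i
    ⟦⟧-fs (flat _ _ _ _) (_ , _ , _ , hf) = hf

    ⟦ε⟧ : ⟦ ε ⟧ i
    ⟦ε⟧ = ⊥⊆ , Always-∅ , [] , tt

    AllEventually-++⁺ : ∀ f {f′} → AllEventually f i → AllEventually f′ i → AllEventually (f ++ f′) i
    AllEventually-++⁺ []      _        hf′ = hf′
    AllEventually-++⁺ (_ ∷ f) (e , hf) hf′ = e , AllEventually-++⁺ f hf hf′

    AllEventually-++⁻ : ∀ f {f′} → AllEventually (f ++ f′) i → AllEventually f i × AllEventually f′ i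
    AllEventually-++⁻ []      hf        = tt , hf
    AllEventually-++⁻ (_ ∷ f) (e , hf) with AllEventually-++⁻ f hf
    ... | hf₁ , hf₂ = (e , hf₁) , hf₂

    ⊗⁺ : ∀ a b → ⟦ a ⟧ i → ⟦ b ⟧ i → ⟦ a ⊗ b ⟧ i
    ⊗⁺ (flat _ _ _ f) (flat _ _ _ _) (hp , hg , hl , hf) (hp′ , hg′ , hl′ , hf′) =
      ∪-⊆ hp hp′ , Always-∪ hg hg′ , ++⁺ hl hl′ , AllEventually-++⁺ f hf hf′

    ⊗⁻ : ∀ a b → ⟦ a ⊗ b ⟧ i → ⟦ a ⟧ i × ⟦ b ⟧ i
    ⊗⁻ (flat _ _ l f) (flat _ _ _ _) (hp , hg , hl , hf)
      with ∪-⊆⁻ hp | Always-∪⁻ hg | ++⁻ l hl | AllEventually-++⁻ f hf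
    ... | hp₁ , hp₂ | hg₁ , hg₂ | hl₁ , hl₂ | hf₁ , hf₂ = (hp₁ , hg₁ , hl₁ , hf₁) , (hp₂ , hg₂ , hl₂ , hf₂)

  open FlatSemantics _≤_

  Sat : Form n → ℕ → Set
  Sat φ i = _,_⊨_ w i φ

  AtomsSuffice : Form n → ℕ → Set
  AtomsSuffice φ i = Holds (atoms φ) i → Sat φ i

  atoms-sound : ∀ φ → Sat φ i → Holds (atoms φ) i
  atoms-sound tt       _        = ⊥⊆
  atoms-sound (atom a) a∈       x∈ = subst (_∈ w _) (sym (x∈⁅y⁆⇒x≡y a x∈)) a∈
  atoms-sound (φ ∧ ψ)  (h , h′) = ∪-⊆ (atoms-sound φ h) (atoms-sound ψ h′)
  atoms-sound (𝐅 _)    _        = ⊥⊆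
  atoms-sound (𝐆 _)    _        = ⊥⊆

  AtomsSuffice-∧ : ∀ φ ψ → AtomsSuffice φ i → AtomsSuffice ψ i → AtomsSuffice (φ ∧ ψ) i
  AtomsSuffice-∧ φ ψ h h′ at = let at₁ , at₂ = ∪-⊆⁻ {q = atoms ψ} at in h at₁ , h′ at₂

  AtomsSuffice-atom : ∀ a → AtomsSuffice (atom a) i
  AtomsSuffice-atom a at = at (x∈⁅x⁆ a)

  flatFG′≡flatGF′ : (φ : Form n) → flatFG' φ ≡ flatGF' φ
  flatFG′≡flatGF′ tt       = refl
  flatFG′≡flatGF′ (atom _) = refl
  flatFG′≡flatGF′ (φ ∧ ψ)  = cong₂ _⊗_ (flatFG′≡flatGF′ φ) (flatFG′≡flatGF′ ψ)
  flatFG′≡flatGF′ (𝐅 _)    = refl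
  flatFG′≡flatGF′ (𝐆 _)    = refl

  flatTop⁺ : ∀ φ → Sat φ i → ⟦ flatTop φ ⟧ i
  flatTop′⁺ : ∀ φ → Sat φ i → ⟦ flatTop' φ ⟧ i
  flatG⁺ : ∀ φ → Sat (𝐆 φ) i → ⟦ flatG φ ⟧ i
  flatG′⁺ : ∀ φ → Sat (𝐆 φ) i → ⟦ flatG' φ ⟧ i
  flatGF⁺ : ∀ φ → Sat (𝐆 (𝐅 φ)) i → ⟦ flatGF φ ⟧ i
  flatGF′⁺ : ∀ φ → Sat (𝐆 (𝐅 φ)) i → ⟦ flatGF' φ ⟧ i
  flatFG⁺ : ∀ φ → Sat (𝐅 (𝐆 φ)) i → ⟦ flatFG φ ⟧ i

  flatTop⁺ φ h =
    ⊗⁺ (flat (atoms φ) ∅ [] []) (flatTop' φ) (atoms-sound φ h , Always-∅ , [] , tt) (flatTop′⁺ φ h)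

  flatTop′⁺ tt       _        = ⟦ε⟧
  flatTop′⁺ (atom _) _        = ⟦ε⟧
  flatTop′⁺ (φ ∧ ψ)  (h , h′) = ⊗⁺ (flatTop' φ) (flatTop' ψ) (flatTop′⁺ φ h) (flatTop′⁺ ψ h′)
  flatTop′⁺ (𝐅 φ)    h        = ⊥⊆ , Always-∅ , [] , (◇-map (flatTop⁺ φ) h , tt)
  flatTop′⁺ (𝐆 φ)    h        = flatG⁺ φ h

  flatG⁺ φ h =
    ⊗⁺ (flat ∅ (atoms φ) [] []) (flatG' φ) (⊥⊆ , □-map (atoms-sound φ) h , [] , tt) (flatG′⁺ φ h)

  flatG′⁺ tt       _ = ⟦ε⟧
  flatG′⁺ (atom _) _ = ⟦ε⟧
  flatG′⁺ (φ ∧ ψ)  h = ⊗⁺ (flatG' φ) (flatG' ψ) (flatG′⁺ φ (□-map proj₁ h)) (flatG′⁺ ψ (□-map proj₂ h))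
  flatG′⁺ (𝐅 φ)    h = flatGF⁺ φ h
  flatG′⁺ (𝐆 φ)    h = flatG⁺ φ (□-now h)

  flatGF⁺ φ h = ⊗⁺ (flat ∅ ∅ (atoms φ ∷ []) []) (flatGF' φ)
    (⊥⊆ , Always-∅ , □-map (◇-map (atoms-sound φ)) h ∷ [] , tt) (flatGF′⁺ φ h)

  flatGF′⁺ tt       _ = ⟦ε⟧
  flatGF′⁺ (atom _) _ = ⟦ε⟧
  flatGF′⁺ (φ ∧ ψ)  h = ⊗⁺ (flatGF' φ) (flatGF' ψ)
    (flatGF′⁺ φ (□-map (◇-map proj₁) h)) (flatGF′⁺ ψ (□-map (◇-map proj₂) h))
  flatGF′⁺ (𝐅 φ)    h = flatGF⁺ φ (□-map ◇-join h)
  flatGF′⁺ (𝐆 φ)    h = flatFG⁺ φ (□-now h)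

  flatFG⁺ {i = i} φ h = ⊗⁺ (flat ∅ ∅ [] (flat ∅ (atoms φ) [] [] ∷ [])) (flatFG' φ)
    (⊥⊆ , Always-∅ , [] , (◇-map always-atoms h , tt))
    (subst (λ q → ⟦ q ⟧ i) (sym (flatFG′≡flatGF′ φ)) (flatGF′⁺ φ (◇□⇒□◇ h)))
    where
    always-atoms : ∀ {j} → Sat (𝐆 φ) j → ⟦ flat ∅ (atoms φ) [] [] ⟧ j
    always-atoms g = ⊥⊆ , □-map (atoms-sound φ) g , [] , tt

  flatTop⁻ : ∀ φ → ⟦ flatTop φ ⟧ i → Sat φ i
  flatTop′⁻ : ∀ φ → ⟦ flatTop' φ ⟧ i → AtomsSuffice φ i
  flatG⁻ : ∀ φ → ⟦ flatG φ ⟧ i → Sat (𝐆 φ) i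
  flatG′⁻ : ∀ φ → ⟦ flatG' φ ⟧ i → □ (AtomsSuffice φ) i
  flatGF⁻ : ∀ φ → ⟦ flatGF φ ⟧ i → Sat (𝐆 (𝐅 φ)) i
  flatGF′⁻ : ∀ φ → ⟦ flatGF' φ ⟧ i → ◇ (□ (AtomsSuffice φ)) i
  flatFG⁻ : ∀ φ → ⟦ flatFG φ ⟧ i → Sat (𝐅 (𝐆 φ)) i

  flatTop⁻ φ h with ⊗⁻ (flat (atoms φ) ∅ [] []) (flatTop' φ) h
  ... | (at , _) , h′ = flatTop′⁻ φ h′ at

  flatTop′⁻ tt       _ _ = tt
  flatTop′⁻ (atom a) _   = AtomsSuffice-atom a
  flatTop′⁻ (φ ∧ ψ)  h with ⊗⁻ (flatTop' φ) (flatTop' ψ) h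
  ... | h₁ , h₂ = AtomsSuffice-∧ φ ψ (flatTop′⁻ φ h₁) (flatTop′⁻ ψ h₂)
  flatTop′⁻ (𝐅 φ) (_ , _ , _ , e , _) _ = ◇-map (flatTop⁻ φ) e
  flatTop′⁻ (𝐆 φ) h                   _ = flatG⁻ φ h

  flatG⁻ φ h with ⊗⁻ (flat ∅ (atoms φ) [] []) (flatG' φ) h
  ... | (_ , at , _) , h′ = □-mp at (flatG′⁻ φ h′)

  flatG′⁻ tt       _ _ _ _ = tt
  flatG′⁻ (atom a) _ _ _   = AtomsSuffice-atom a
  flatG′⁻ (φ ∧ ψ)  h with ⊗⁻ (flatG' φ) (flatG' ψ) h
  ... | h₁ , h₂ = □-zipWith (AtomsSuffice-∧ φ ψ) (flatG′⁻ φ h₁) (flatG′⁻ ψ h₂)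
  flatG′⁻ (𝐅 φ)    h = □-map const (flatGF⁻ φ h)
  flatG′⁻ (𝐆 φ)    h = □-map const (□-dup (flatG⁻ φ h))

  flatGF⁻ φ h with ⊗⁻ (flat ∅ ∅ (atoms φ ∷ []) []) (flatGF' φ) h
  ... | (_ , _ , inf ∷ [] , _) , h′ = □◇-mp inf (flatGF′⁻ φ h′)

  flatGF′⁻ tt       _ = ◇-here λ _ _ _ → tt
  flatGF′⁻ (atom a) _ = ◇-here λ _ _ → AtomsSuffice-atom a
  flatGF′⁻ (φ ∧ ψ)  h with ⊗⁻ (flatGF' φ) (flatGF' ψ) h
  ... | h₁ , h₂ = ◇□-zipWith (AtomsSuffice-∧ φ ψ) (flatGF′⁻ φ h₁) (flatGF′⁻ ψ h₂)
  flatGF′⁻ (𝐅 φ)    h = ◇-here (□-map const (flatGF⁻ φ h))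
  flatGF′⁻ (𝐆 φ)    h = ◇-map (λ g → □-map const (□-dup g)) (flatFG⁻ φ h)

  flatFG⁻ {i = i} φ h with ⊗⁻ (flat ∅ ∅ [] (flat ∅ (atoms φ) [] [] ∷ [])) (flatFG' φ) h
  ... | (_ , _ , _ , (j , i≤j , _ , at , _) , _) , h′ =
    ◇□-mp (j , i≤j , at) (flatGF′⁻ φ (subst (λ q → ⟦ q ⟧ i) (flatFG′≡flatGF′ φ) h′))

  Unf⁻ : ∀ {q u : Flat n} → Unf q u → ⟦ u ⟧ i → ⟦ q ⟧ i
  UnfL⁻ : ∀ {f : List (Flat n)} {r} → UnfL f r → ⟦ r ⟧ i → AllEventually f i

  Unf⁻ (unf {p} {g} {l} {r = r} f↝r) h with ⊗⁻ (flat p g l []) r h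
  ... | (hp , hg , hl , _) , hr = hp , hg , hl , UnfL⁻ f↝r hr

  UnfL⁻ []                          _ = tt
  UnfL⁻ (keep {φ} {r = r} f↝r)      h with ⊗⁻ (flat ∅ ∅ [] (φ ∷ [])) r h
  ... | (_ , _ , _ , e , _) , hr = e , UnfL⁻ f↝r hr
  UnfL⁻ (open′ {s = s} {r} φ↝s f↝r) h with ⊗⁻ s r h
  ... | hs , hr = ◇-here (Unf⁻ φ↝s hs) , UnfL⁻ f↝r hr

  AllEventually-back : ∀ f → AllEventually f (suc i) → AllEventually f i
  AllEventually-back []      _                      = tt
  AllEventually-back (_ ∷ f) ((j , 1+i≤j , h) , hf) =
    (j , ≤-trans (n≤1+n _) 1+i≤j , h) , AllEventually-back f hf

  Step⁻ : ∀ {q q′ : Flat n} → Step q (w i) q′ → ⟦ q′ ⟧ (suc i) → ⟦ q ⟧ i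
  Step⁻ (flat _ g _ f , q↝u , u⊆A , refl) (_ , hg , hl , hf) =
    Unf⁻ q↝u ( proj₁ (∪-⊆⁻ u⊆A) , □-back {P = Holds g} (proj₂ (∪-⊆⁻ {q = g} u⊆A)) hg
             , All-map □◇-back hl , AllEventually-back f hf)

  module _ {ρ : ℕ → Flat n} (steps : ∀ i → Step (ρ i) (w i) (ρ (suc i))) where

    run⁻ : ∀ t → ⟦ ρ t ⟧ t → ⟦ ρ 0 ⟧ 0
    run⁻ zero    h = h
    run⁻ (suc t) h = run⁻ t (Step⁻ (steps t) h)

    run-glob-mono : t ≤′ j → glob (ρ t) ⊆ glob (ρ j)
    run-glob-mono ≤′-refl        = id
    run-glob-mono (≤′-step t≤′j) = Step-glob-mono (steps _) ∘ run-glob-mono t≤′j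

    final⁻ : fs (ρ t) ≡ [] → All (λ s → InfOften s t) (gf (ρ t)) → ⟦ ρ t ⟧ t
    final⁻ {t} fs≡[] inf =
      ⟦⟧-intro (ρ t) (Step-now (steps t))
        (λ j t≤j → Step-glob (steps j) ∘ run-glob-mono (≤⇒≤′ t≤j))
        inf (subst (λ f → AllEventually f t) (sym fs≡[]) tt)

  module _ {W W′ : ℕ → ℕ → Set} (W⇒W′ : ∀ {i j} → W i j → W′ i j) where
    private
      module S  = FlatSemantics W
      module S′ = FlatSemantics W′

    ⟦⟧-mono : ∀ q → S.⟦ q ⟧ i → S′.⟦ q ⟧ i
    AllEventually-mono : ∀ f → S.AllEventually f i → S′.AllEventually f i

    ⟦⟧-mono (flat _ _ _ f) (hp , hg , hl , hf) = hp , hg , hl , AllEventually-mono f hf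

    AllEventually-mono []      _                    = tt
    AllEventually-mono (φ ∷ f) ((j , ij , h) , hf) = (j , W⇒W′ ij , ⟦⟧-mono φ h) , AllEventually-mono f hf

  bounded : ∀ q → ⟦ q ⟧ i → ∃[ D ] FlatSemantics.⟦_⟧ (Within D) q i
  boundedL : ∀ f → AllEventually f i → ∃[ D ] FlatSemantics.AllEventually (Within D) f i

  bounded (flat _ _ _ f) (hp , hg , hl , hf) = let D , hf′ = boundedL f hf in D , hp , hg , hl , hf′

  boundedL []      _                    = 0 , tt
  boundedL (φ ∷ f) ((j , i≤j , h) , hf) =
    let D₁ , h′  = bounded φ h
        D₂ , hf′ = boundedL f hf
    in j ⊔ D₁ ⊔ D₂ ,
       (j , (i≤j , m≤n⇒m≤n⊔o D₂ (m≤m⊔n j D₁)) , ⟦⟧-mono (Within-mono (m≤n⇒m≤n⊔o D₂ (m≤n⊔m j D₁))) φ h′) ,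
       AllEventually-mono (Within-mono (m≤n⊔m (j ⊔ D₁) D₂)) f hf′

  module BoundedRun (D : ℕ) where
    private
      module B = FlatSemantics (Within D)

    Deferred : Flat n → ℕ → Set
    Deferred u i = Holds (now u) i × Always (glob u) i × All (λ s → InfOften s i) (gf u) ×
                   B.AllEventually (fs u) (suc i)

    Deferred-⊗ : ∀ a b → Deferred a i → Deferred b i → Deferred (a ⊗ b) i
    Deferred-⊗ (flat _ _ _ f) (flat _ _ _ _) (hp , hg , hl , hf) (hp′ , hg′ , hl′ , hf′) =
      ∪-⊆ hp hp′ , Always-∪ hg hg′ , ++⁺ hl hl′ , B.AllEventually-++⁺ f hf hf′

    -- An obligation is opened exactly at its witness and kept otherwise.
    unfold : ∀ q → B.⟦ q ⟧ i → Σ[ u ∈ Flat n ] (Unf q u × Deferred u i)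
    unfoldL : ∀ f → B.AllEventually f i → Σ[ r ∈ Flat n ] (UnfL f r × Deferred r i)

    unfold (flat p g l f) (hp , hg , hl , hf) =
      let r , f↝r , hr = unfoldL f hf in
      flat p g l [] ⊗ r , unf f↝r , Deferred-⊗ (flat p g l []) r (hp , hg , hl , tt) hr

    unfoldL []      _ = ε , [] , ⊥⊆ , Always-∅ , [] , tt
    unfoldL (φ ∷ f) ((j , (i≤j , j≤D) , h) , hf) with unfoldL f hf | m≤n⇒m<n∨m≡n i≤j
    ... | r , f↝r , hr | inj₁ i<j =
      flat ∅ ∅ [] (φ ∷ []) ⊗ r , keep f↝r ,
      Deferred-⊗ (flat ∅ ∅ [] (φ ∷ [])) r (⊥⊆ , Always-∅ , [] , (j , (i<j , j≤D) , h) , tt) hr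
    ... | r , f↝r , hr | inj₂ refl =
      let s , φ↝s , hs = unfold φ h in
      s ⊗ r , open′ φ↝s f↝r , Deferred-⊗ s r hs hr

    step : ∀ q → B.⟦ q ⟧ i → Σ[ q′ ∈ Flat n ] (Step q (w i) q′ × B.⟦ q′ ⟧ (suc i))
    step {i} q h =
      let u , q↝u , hp , hg , hl , hf = unfold q h in
      flat ∅ (glob u) (gf u) (fs u) , (u , q↝u , ∪-⊆ hp (□-now hg) , refl) ,
      ⊥⊆ , □-later (n≤1+n i) hg , All-map (□-later (n≤1+n i)) hl , hf

    expired : ∀ f → D < i → B.AllEventually f i → f ≡ []
    expired []      _   _                           = refl
    expired (_ ∷ _) D<i ((_ , (i≤j , j≤D) , _) , _) = contradiction (≤-trans i≤j j≤D) (<⇒≱ D<i)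

    module _ (φ : Form n) (h₀ : B.⟦ q₀ φ ⟧ 0) where

      run : ∀ i → Σ[ q ∈ Flat n ] B.⟦ q ⟧ i
      run zero    = q₀ φ , h₀
      run (suc i) = let q′ , _ , h′ = step (proj₁ (run i)) (proj₂ (run i)) in q′ , h′

      ρ : ℕ → Flat n
      ρ i = proj₁ (run i)

      steps : ∀ i → Step (ρ i) (w i) (ρ (suc i))
      steps i = proj₁ (proj₂ (step (ρ i) (proj₂ (run i))))

      T : ℕ
      T = suc D

      obligations-expired : ∀ {k} → T ≤ k → fs (ρ k) ≡ []
      obligations-expired {k} T≤k = expired _ T≤k (B.⟦⟧-fs (ρ k) (proj₂ (run k)))

      -- A state entered by a step has an empty present part, hence the refl.
      settled : ∀ k → T ≤ k → ρ (suc k) ≡ ρ k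
      settled (suc k) T≤1+k = Step-idle (ρ (suc k)) refl (obligations-expired T≤1+k) (steps (suc k))

      stays : ∀ {k} → T ≤ k → ρ k ≡ ρ T
      stays T≤k = eventually-constant settled (≤⇒≤′ T≤k)

      visits : ∀ {s} → InfOften s T → ∀ m → ∃[ k ] (m ≤ k × ρ k ≡ ρ T × ρ (suc k) ≡ ρ T × Holds s k)
      visits inf m =
        let k , m⊔T≤k , sk = inf (m ⊔ T) (m≤n⊔m m T)
            T≤k = m⊔n≤o⇒n≤o m T m⊔T≤k
        in k , m⊔n≤o⇒m≤o m T m⊔T≤k , stays T≤k , stays (≤-trans T≤k (n≤1+n k)) , sk

      accepted : Accepted φ w
      accepted =
        ρ , (refl , steps) , ρ T ,
        (run-Reach⁺ steps D , fs≡[]⇒#F≡0 (ρ T) (obligations-expired ≤-refl)) ,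
        T , refl , All-map visits (B.⟦⟧-gf (ρ T) (proj₂ (run T)))

  ⊨⇒Accepted : ∀ φ → w ⊨ φ → Accepted φ w
  ⊨⇒Accepted φ h = let D , h′ = bounded (q₀ φ) (flatTop⁺ φ h) in BoundedRun.accepted D φ h′

  Accepted⇒⊨ : ∀ φ → Accepted φ w → w ⊨ φ
  Accepted⇒⊨ φ (ρ , (ρ₀ , steps) , q , ((_ , #F≡0) , t , refl , fair)) =
    flatTop⁻ φ (subst (λ q → ⟦ q ⟧ 0) ρ₀
      (run⁻ steps t (final⁻ steps (#F≡0⇒fs≡[] q #F≡0) (All-map infOften fair))))
    where
    infOften : ∀ {s} → (∀ m → ∃[ k ] (m ≤ k × ρ k ≡ q × ρ (suc k) ≡ q × Holds s k)) → InfOften s t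
    infOften h j _ = let k , j≤k , _ , _ , sk = h j in k , j≤k , sk

proposition7 : ∀ {n : ℕ} (φ : Form n) (w : Word n) → (w ⊨ φ) ⇔ Accepted φ w
proposition7 φ w = mk⇔ (⊨⇒Accepted w φ) (Accepted⇒⊨ w φ)
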